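{- For integers $n$ and $\ell$ with $1\le \ell<n-1$, $$ c^{(\ell)}(n,n-1)=\frac{\left\lceil \frac{2n}{n-\ell}\right\rceil}{2^{n-\ell}\binom{n}{\ell}}, $$ i.e. the minimum size of an $(n-1,\ell)$-covering set of $Q_n$ is $\left\lceil \frac{2n}{n-\ell}\right\rceil$.
   Context: $Q_n$ is the $n$-dimensional hypercube on $\{0,1\}^n$, edges joining vertices differing in exactly one coordinate. For $1\le i\le n-1$, a copy of $Q_i$ in $Q_n$ (subcube) is the subgraph induced by all vertices agreeing with a fixed $0/1$ assignment on a fixed set of $n-i$ coordinates; $\mathcal{H}_n^i$ is the set of these copies, so $|\mathcal{H}_n^i|=2^{n-i}\binom{n}{i}$. For $\ell<d$, a subset $S\subseteq\mathcal{H}_n^\ell$ is a $(d,\ell)$-covering set if every member of $\mathcal{H}_n^d$ contains (as a subcube) some member of $S$. $f^{(\ell)}(n,d)$ is the minimum size of a $(d,\ell)$-covering set and $c^{(\ell)}(n,d)=f^{(\ell)}(n,d)/\left(2^{n-\ell}\binom{n}{\ell}\right)$. -}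

module Defs where

open import Data.Nat using (ℕ; zero; suc; _+_; _∸_; _≤_)
open import Data.Nat.DivMod using (_/_)
open import Data.Bool using (Bool)
open import Data.Maybe using (Maybe; just; nothing)
open import Data.Vec using (Vec; []; _∷_)
open import Data.List using (List; length)
open import Data.List.Relation.Unary.All using (All)
open import Data.List.Relation.Unary.Any using (Any)
open import Data.List.Relation.Unary.Unique.Propositional using (Unique)
open import Data.Product using (Σ; _×_)
open import Relation.Binary.PropositionalEquality using (_≡_)

-- A subcube of Q_n: for each coordinate either a fixed bit (just b) or
-- a free coordinate (nothing). The subcube is the set of vertices of
-- {0,1}^n agreeing with all fixed bits.
Subcube : ℕ → Set
Subcube n = Vec (Maybe Bool) n

dim : ∀ {n} → Subcube n → ℕ
dim [] = 0
dim (nothing ∷ c) = suc (dim c)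
dim (just _ ∷ c) = dim c

data _⊑ᵒ_ : Maybe Bool → Maybe Bool → Set where
  any-free : ∀ {x} → x ⊑ᵒ nothing
  same     : ∀ {b} → just b ⊑ᵒ just b

-- C is a subcube of D (vertex set of C contained in vertex set of D)
data _⊑_ : ∀ {n} → Subcube n → Subcube n → Set where
  []  : [] ⊑ []
  _∷_ : ∀ {n x y} {c d : Subcube n} → x ⊑ᵒ y → c ⊑ d → (x ∷ c) ⊑ (y ∷ d)

-- S (a finite set of distinct copies of Q_ℓ, given as a duplicate-free list)
-- is a (d,ℓ)-covering set of Q_n.
IsCoveringSet : (n d ℓ : ℕ) → List (Subcube n) → Set
IsCoveringSet n d ℓ S =
  Unique S × All (λ C → dim C ≡ ℓ) S ×
  ((D : Subcube n) → dim D ≡ d → Any (λ C → C ⊑ D) S)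

IsMinCoveringSize : (n d ℓ k : ℕ) → Set
IsMinCoveringSize n d ℓ k =
  Σ (List (Subcube n)) (λ S → IsCoveringSet n d ℓ S × length S ≡ k) ×
  ((S : List (Subcube n)) → IsCoveringSet n d ℓ S → k ≤ length S)

-- ceiling division ⌈a / b⌉ (b = 0 gives 0; never used with b = 0 here)
ceilDiv : ℕ → ℕ → ℕ
ceilDiv a zero = 0
ceilDiv a (suc b) = (a + b) / suc b

-- A copy of Q_ℓ fixes n - ℓ coordinates and so lies in exactly n - ℓ of the 2n facets
-- x_i = b of Q_n, and a member of H_n^{n-1} is such a facet.  Double counting the incidences
-- between a covering set and the facets gives 2n ≤ |S| (n - ℓ).  Conversely, list the 2n
-- facets as x_0 = 0, …, x_{n-1} = 0, x_0 = 1, …, x_{n-1} = 1 and cut the list into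
-- ⌈2n/(n - ℓ)⌉ blocks of n - ℓ consecutive facets; fixing the coordinates named by a block
-- (and a few more if the block is short) gives a copy of Q_ℓ inside every facet of the block.
module Submission where

open import Defs
open import Data.Nat using (ℕ; _≤_; _<_; _∸_; _*_)
open import Data.Nat.Base using (zero; suc; _+_; z≤n; s≤s; z<s; s<s; NonZero)
open import Data.Nat.Properties hiding (_≟_)
open import Data.Nat.DivMod using (_/_; _%_; m/n*n≤m; m≡m%n+[m/n]*n; m%n<n; m<n*o⇒m/o<n)
open import Data.Nat.ListAction using (sum)
open import Data.Nat.ListAction.Properties using (sum-++)
open import Algebra.Properties.CommutativeSemigroup +-commutativeSemigroup using (interchange)
open import Data.Bool using (Bool; true; false; _∧_)
import Data.Bool.Properties as Bool
open import Data.Maybe using (Maybe; just; nothing; is-just)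
import Data.Maybe.Properties as Maybe
open import Data.Vec using ([]; _∷_; replicate)
import Data.Vec.Properties as Vec
open import Data.List using (List; []; _∷_; _++_; length; map; applyUpTo; deduplicate)
open import Data.List.Properties using (map-∘; length-map; length-applyUpTo; length-deduplicate)
open import Data.List.Relation.Unary.All using (All; []; _∷_)
import Data.List.Relation.Unary.All as All
import Data.List.Relation.Unary.All.Properties as All
open import Data.List.Relation.Unary.Any using (Any; here; there)
import Data.List.Relation.Unary.Any.Properties as Any
open import Data.List.Relation.Unary.Unique.DecPropositional.Properties using (deduplicate-!)
open import Data.Product using (∃; ∃₂; _×_; _,_; uncurry)
open import Data.Empty using (⊥-elim)
open import Function using (_∘_)
open import Relation.Nullary using (Dec; yes; no; does)
open import Relation.Nullary.Decidable using (map′; _×-dec_; dec-true)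
open import Relation.Binary.Definitions using (Decidable; DecidableEquality)
open import Relation.Binary.PropositionalEquality

indicator : Bool → ℕ
indicator true  = 1
indicator false = 0

private variable
  A B : Set

count : {P : A → Set} → (∀ x → Dec (P x)) → List A → ℕ
count P? xs = sum (map (λ x → indicator (does (P? x))) xs)

Any⇒1≤count : ∀ {P : A → Set} (P? : ∀ x → Dec (P x)) {xs} → Any P xs → 1 ≤ count P? xs
Any⇒1≤count P? {x ∷ _} (here px) rewrite dec-true (P? x) px = s≤s z≤n
Any⇒1≤count P? {x ∷ _} (there pxs) = ≤-trans (Any⇒1≤count P? pxs) (m≤n+m _ _)

sum-map-zero : (xs : List A) → sum (map (λ _ → 0) xs) ≡ 0
sum-map-zero []       = refl
sum-map-zero (_ ∷ xs) = sum-map-zero xs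

sum-map-+ : (f g : A → ℕ) (xs : List A) →
  sum (map (λ x → f x + g x) xs) ≡ sum (map f xs) + sum (map g xs)
sum-map-+ f g []       = refl
sum-map-+ f g (x ∷ xs) =
  trans (cong (f x + g x +_) (sum-map-+ f g xs)) (interchange (f x) (g x) _ _)

sum-map-const : (f : A → ℕ) {k : ℕ} (xs : List A) →
  All (λ x → f x ≡ k) xs → sum (map f xs) ≡ length xs * k
sum-map-const f []       []           = refl
sum-map-const f (x ∷ xs) (fx≡k ∷ fxs) = cong₂ _+_ fx≡k (sum-map-const f xs fxs)

length≤sum-map : (f : A → ℕ) (xs : List A) → All (λ x → 1 ≤ f x) xs →
  length xs ≤ sum (map f xs)
length≤sum-map f []       []           = z≤n
length≤sum-map f (x ∷ xs) (1≤fx ∷ fxs) = +-mono-≤ 1≤fx (length≤sum-map f xs fxs)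

sum-map-comm : (f : A → B → ℕ) (xs : List A) (ys : List B) →
  sum (map (λ y → sum (map (λ x → f x y) xs)) ys) ≡ sum (map (λ x → sum (map (f x) ys)) xs)
sum-map-comm f []       ys = sum-map-zero ys
sum-map-comm f (x ∷ xs) ys =
  trans (sum-map-+ (f x) (λ y → sum (map (λ x → f x y) xs)) ys)
        (cong (sum (map (f x) ys) +_) (sum-map-comm f xs ys))

sum-applyUpTo-mono : ∀ {f g : ℕ → ℕ} n → (∀ i → f i ≤ g i) →
  sum (applyUpTo f n) ≤ sum (applyUpTo g n)
sum-applyUpTo-mono zero    f≤g = z≤n
sum-applyUpTo-mono (suc n) f≤g = +-mono-≤ (f≤g 0) (sum-applyUpTo-mono n (f≤g ∘ suc))

sum-applyUpTo-+ : ∀ (f g : ℕ → ℕ) n →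
  sum (applyUpTo (λ i → f i + g i) n) ≡ sum (applyUpTo f n) + sum (applyUpTo g n)
sum-applyUpTo-+ f g zero    = refl
sum-applyUpTo-+ f g (suc n) =
  trans (cong (f 0 + g 0 +_) (sum-applyUpTo-+ (f ∘ suc) (g ∘ suc) n))
        (interchange (f 0) (g 0) _ _)

applyUpTo-+ : ∀ (f : ℕ → A) m n →
  applyUpTo f (m + n) ≡ applyUpTo f m ++ applyUpTo (λ i → f (m + i)) n
applyUpTo-+ f zero    n = refl
applyUpTo-+ f (suc m) n = cong (f 0 ∷_) (applyUpTo-+ (f ∘ suc) m n)

m≤o*n⇒ceilDiv≤o : ∀ {a b k} → a ≤ k * suc b → ceilDiv a (suc b) ≤ k
m≤o*n⇒ceilDiv≤o {a} {b} {k} a≤k*n = ≤-pred (m<n*o⇒m/o<n (s≤s (begin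
  a + b         ≤⟨ +-monoˡ-≤ b a≤k*n ⟩
  k * suc b + b ≡⟨ +-comm (k * suc b) b ⟩
  b + k * suc b ∎)))
  where open ≤-Reasoning

m≤ceilDiv*n : ∀ a b → a ≤ ceilDiv a (suc b) * suc b
m≤ceilDiv*n a b = +-cancelˡ-≤ b a _ (begin
  b + a                           ≡⟨ +-comm b a ⟩
  a + b                           ≡⟨ m≡m%n+[m/n]*n (a + b) (suc b) ⟩
  (a + b) % suc b + k * suc b     ≤⟨ +-monoˡ-≤ _ (≤-pred (m%n<n (a + b) (suc b))) ⟩
  b + k * suc b                   ∎)
  where
  open ≤-Reasoning
  k = ceilDiv a (suc b)

fullCube : ∀ n → Subcube n
fullCube n = replicate n nothing

codim : ∀ {n} → Subcube n → ℕ
codim []      = 0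
codim (x ∷ c) = indicator (is-just x) + codim c

codim+dim : ∀ {n} (c : Subcube n) → codim c + dim c ≡ n
codim+dim []            = refl
codim+dim (nothing ∷ c) = trans (+-suc (codim c) (dim c)) (cong suc (codim+dim c))
codim+dim (just _ ∷ c)  = cong suc (codim+dim c)

codim≡n∸dim : ∀ {n} (c : Subcube n) → codim c ≡ n ∸ dim c
codim≡n∸dim c = trans (sym (m+n∸n≡m (codim c) (dim c))) (cong (_∸ dim c) (codim+dim c))

dim≡n∸codim : ∀ {n} (c : Subcube n) → dim c ≡ n ∸ codim c
dim≡n∸codim c = trans (sym (m+n∸m≡n (codim c) (dim c))) (cong (_∸ codim c) (codim+dim c))

dim≤n : ∀ {n} (c : Subcube n) → dim c ≤ n
dim≤n c = subst (dim c ≤_) (codim+dim c) (m≤n+m (dim c) (codim c))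

⊑ᵒ-refl : ∀ x → x ⊑ᵒ x
⊑ᵒ-refl nothing  = any-free
⊑ᵒ-refl (just _) = same

⊑-refl : ∀ {n} (c : Subcube n) → c ⊑ c
⊑-refl []      = []
⊑-refl (x ∷ c) = ⊑ᵒ-refl x ∷ ⊑-refl c

⊑ᵒ-trans : ∀ {x y z} → x ⊑ᵒ y → y ⊑ᵒ z → x ⊑ᵒ z
⊑ᵒ-trans _    any-free = any-free
⊑ᵒ-trans same same     = same

⊑-trans : ∀ {n} {c d e : Subcube n} → c ⊑ d → d ⊑ e → c ⊑ e
⊑-trans []       []       = []
⊑-trans (p ∷ ps) (q ∷ qs) = ⊑ᵒ-trans p q ∷ ⊑-trans ps qs

⊑-fullCube : ∀ {n} (c : Subcube n) → c ⊑ fullCube n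
⊑-fullCube []      = []
⊑-fullCube (_ ∷ c) = any-free ∷ ⊑-fullCube c

dim≡n⇒⊒ : ∀ {n} {d : Subcube n} → dim d ≡ n → (c : Subcube n) → c ⊑ d
dim≡n⇒⊒ {d = []}          _     []      = []
dim≡n⇒⊒ {d = nothing ∷ d} dim≡n (_ ∷ c) = any-free ∷ dim≡n⇒⊒ (suc-injective dim≡n) c
dim≡n⇒⊒ {d = just _ ∷ d}  dim≡n _       = ⊥-elim (1+n≰n (subst (_≤ _) dim≡n (dim≤n d)))

_⊑ᵒ?_ : Decidable _⊑ᵒ_
_      ⊑ᵒ? nothing = yes any-free
nothing ⊑ᵒ? just _ = no λ ()
just a ⊑ᵒ? just b  = map′ (λ { refl → same }) (λ { same → refl }) (a Bool.≟ b)

_⊑?_ : ∀ {n} → Decidable (_⊑_ {n})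
[]      ⊑? []      = yes []
(x ∷ c) ⊑? (y ∷ d) = map′ (uncurry _∷_) (λ { (p ∷ q) → p , q }) (x ⊑ᵒ? y ×-dec c ⊑? d)

_≟_ : ∀ {n} → DecidableEquality (Subcube n)
_≟_ = Vec.≡-dec (Maybe.≡-dec Bool._≟_)

facets : ∀ n → List (Subcube n)
facets zero    = []
facets (suc n) =
  (just false ∷ fullCube n) ∷ (just true ∷ fullCube n) ∷ map (nothing ∷_) (facets n)

length-facets : ∀ n → length (facets n) ≡ 2 * n
length-facets zero    = refl
length-facets (suc n) = begin
  2 + length (map (nothing ∷_) (facets n)) ≡⟨ cong (2 +_) (length-map _ (facets n)) ⟩
  2 + length (facets n)                    ≡⟨ cong (2 +_) (length-facets n) ⟩
  2 + 2 * n                                ≡⟨ *-distribˡ-+ 2 1 n ⟨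
  2 * suc n                                ∎
  where open ≡-Reasoning

dim-facets : ∀ n → All (λ d → dim d ≡ n) (facets (suc n))
dim-facets zero    = refl ∷ refl ∷ []
dim-facets (suc n) = dim-fullCube ∷ dim-fullCube ∷ All.map⁺ (All.map (cong suc) (dim-facets n))
  where
  dim-fullCube : ∀ {n} → dim (fullCube n) ≡ n
  dim-fullCube {zero}  = refl
  dim-fullCube {suc n} = cong suc dim-fullCube

count-facets : ∀ {n} (c : Subcube n) → count (c ⊑?_) (facets n) ≡ codim c
count-facets []              = refl
count-facets {suc n} (x ∷ c)
  rewrite dec-true (c ⊑? fullCube n) (⊑-fullCube c)
        | sym (map-∘ {g = λ d → indicator (does ((x ∷ c) ⊑? d))} {f = nothing ∷_} (facets n))
        | count-facets c
  = literal-facets x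
  where
  literal-facets : ∀ x → indicator (does (x ⊑ᵒ? just false) ∧ true) +
                         (indicator (does (x ⊑ᵒ? just true) ∧ true) + codim c)
                       ≡ indicator (is-just x) + codim c
  literal-facets nothing      = refl
  literal-facets (just false) = refl
  literal-facets (just true)  = refl

coveringSet-lowerBound : ∀ {n ℓ S} → IsCoveringSet (suc n) n ℓ S →
  2 * suc n ≤ length S * (suc n ∸ ℓ)
coveringSet-lowerBound {n} {ℓ} {S} (_ , dims , covers) = begin
  2 * suc n
    ≡⟨ length-facets (suc n) ⟨
  length F
    ≤⟨ length≤sum-map (λ d → count (_⊑? d) S) F (All.map covered (dim-facets n)) ⟩
  sum (map (λ d → count (_⊑? d) S) F)
    ≡⟨ sum-map-comm (λ c d → indicator (does (c ⊑? d))) S F ⟩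
  sum (map (λ c → count (c ⊑?_) F) S)
    ≡⟨ sum-map-const (λ c → count (c ⊑?_) F) S (All.map (λ {c} → count≡ {c}) dims) ⟩
  length S * (suc n ∸ ℓ)
    ∎
  where
  open ≤-Reasoning
  F = facets (suc n)

  covered : ∀ {d} → dim d ≡ n → 1 ≤ count (_⊑? d) S
  covered {d} dim≡n = Any⇒1≤count (_⊑? d) (covers d dim≡n)

  count≡ : ∀ {c} → dim c ≡ ℓ → count (c ⊑?_) F ≡ suc n ∸ ℓ
  count≡ {c} refl = trans (count-facets c) (codim≡n∸dim c)

deduplicate-coveringSet : ∀ {n d ℓ} (S : List (Subcube n)) → All (λ c → dim c ≡ ℓ) S →
  ((D : Subcube n) → dim D ≡ d → Any (_⊑ D) S) →
  ∃ λ S′ → IsCoveringSet n d ℓ S′ × length S′ ≤ length S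
deduplicate-coveringSet S dims covers =
  deduplicate _≟_ S ,
  (deduplicate-! _≟_ S , All.deduplicate⁺ _≟_ dims ,
   λ D dim≡d → Any.deduplicate⁺ _≟_ (λ { refl c⊑D → c⊑D }) (covers D dim≡d)) ,
  length-deduplicate _≟_ S

isMinCoveringSize : ∀ {n d ℓ k} → (∃ λ S → IsCoveringSet n d ℓ S × length S ≤ k) →
  (∀ S → IsCoveringSet n d ℓ S → k ≤ length S) → IsMinCoveringSize n d ℓ k
isMinCoveringSize (S , covering , |S|≤k) minimal =
  (S , covering , ≤-antisym |S|≤k (minimal S covering)) , minimal

tabulateℕ : ∀ n → (ℕ → Maybe Bool) → Subcube n
tabulateℕ zero    g = []
tabulateℕ (suc n) g = g 0 ∷ tabulateℕ n (g ∘ suc)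

codim-tabulateℕ : ∀ n g → codim (tabulateℕ n g) ≡ sum (applyUpTo (indicator ∘ is-just ∘ g) n)
codim-tabulateℕ zero    g = refl
codim-tabulateℕ (suc n) g = cong (indicator (is-just (g 0)) +_) (codim-tabulateℕ n (g ∘ suc))

facet-literal : ∀ {n} (d : Subcube (suc n)) → dim d ≡ n →
  ∃₂ λ i b → i < suc n × (∀ g → g i ≡ just b → tabulateℕ (suc n) g ⊑ d)
facet-literal (just b ∷ d) dim≡n =
  0 , b , z<s , λ g g0≡b → subst (_⊑ᵒ just b) (sym g0≡b) same ∷ dim≡n⇒⊒ dim≡n _
facet-literal {zero}  (nothing ∷ d) ()
facet-literal {suc n} (nothing ∷ d) dim≡n =
  let i , b , i<n , fixes = facet-literal d (suc-injective dim≡n)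
  in  suc i , b , s<s i<n , λ g gi≡b → any-free ∷ fixes (g ∘ suc) gi≡b

fixFree : ∀ {n} → ℕ → Subcube n → Subcube n
fixFree zero    c             = c
fixFree (suc r) []            = []
fixFree (suc r) (nothing ∷ c) = just false ∷ fixFree r c
fixFree (suc r) (just b ∷ c)  = just b ∷ fixFree (suc r) c

fixFree-⊑ : ∀ {n} r (c : Subcube n) → fixFree r c ⊑ c
fixFree-⊑ zero    c             = ⊑-refl c
fixFree-⊑ (suc r) []            = []
fixFree-⊑ (suc r) (nothing ∷ c) = any-free ∷ fixFree-⊑ r c
fixFree-⊑ (suc r) (just b ∷ c)  = same ∷ fixFree-⊑ (suc r) c

codim-fixFree : ∀ {n} r (c : Subcube n) → r ≤ dim c → codim (fixFree r c) ≡ r + codim c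
codim-fixFree zero    c             _         = refl
codim-fixFree (suc r) (nothing ∷ c) (s≤s r≤d) = cong suc (codim-fixFree r c r≤d)
codim-fixFree (suc r) (just b ∷ c)  r≤d       =
  trans (cong suc (codim-fixFree (suc r) c r≤d)) (sym (+-suc (suc r) (codim c)))

inWindow : ℕ → ℕ → ℕ → Bool
inWindow (suc a) m       zero    = false
inWindow (suc a) m       (suc p) = inWindow a m p
inWindow zero    zero    p       = false
inWindow zero    (suc m) zero    = true
inWindow zero    (suc m) (suc p) = inWindow zero m p

inWindow-inside : ∀ {a m p} → a ≤ p → p < a + m → inWindow a m p ≡ true
inWindow-inside {suc a} {m}     {suc p} (s≤s a≤p) (s≤s p<a+m) = inWindow-inside a≤p p<a+m
inWindow-inside {zero}  {suc m} {zero}  _         _           = refl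
inWindow-inside {zero}  {suc m} {suc p} _         (s≤s p<m)   = inWindow-inside z≤n p<m

inWindow-before : ∀ {a m p} → p < a → inWindow a m p ≡ false
inWindow-before {suc a} {m} {zero}  _         = refl
inWindow-before {suc a} {m} {suc p} (s≤s p<a) = inWindow-before p<a

sum-inWindow≤ : ∀ L a m → sum (applyUpTo (indicator ∘ inWindow a m) L) ≤ m
sum-inWindow≤ zero    a       m       = z≤n
sum-inWindow≤ (suc L) (suc a) m       = sum-inWindow≤ L a m
sum-inWindow≤ (suc L) zero    zero    = sum-inWindow≤ L zero zero
sum-inWindow≤ (suc L) zero    (suc m) = s≤s (sum-inWindow≤ L zero m)

literal : Bool → Bool → Maybe Bool
literal true  _     = just false
literal false true  = just true
literal false false = nothing

indicator-literal : ∀ x y → indicator (is-just (literal x y)) ≤ indicator x + indicator y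
indicator-literal true  _     = s≤s z≤n
indicator-literal false true  = s≤s z≤n
indicator-literal false false = z≤n

-- Position i < n stands for the facet x_i = 0 and position n + i for the facet x_i = 1;
-- the window starting at a consists of the positions a, …, a + m - 1.  Since m ≤ n a
-- window never meets both facets of one coordinate, so it fixes at most m coordinates.
module Windows (n m : ℕ) .{{_ : NonZero m}} (m≤n : m ≤ n) where

  position : Bool → ℕ → ℕ
  position false i = i
  position true  i = n + i

  position<2n : ∀ b {i} → i < n → position b i < 2 * n
  position<2n false i<n = ≤-trans i<n (m≤m+n n _)
  position<2n true  i<n = +-monoʳ-< n (≤-trans i<n (m≤m+n n 0))

  literalAt : ℕ → ℕ → Maybe Bool
  literalAt a i = literal (inWindow a m i) (inWindow a m (n + i))

  windowCube : ℕ → Subcube n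
  windowCube a = tabulateℕ n (literalAt a)

  codim-windowCube≤ : ∀ a → codim (windowCube a) ≤ m
  codim-windowCube≤ a = begin
    codim (windowCube a)
      ≡⟨ codim-tabulateℕ n (literalAt a) ⟩
    sum (applyUpTo (indicator ∘ is-just ∘ literalAt a) n)
      ≤⟨ sum-applyUpTo-mono n (λ i → indicator-literal (W i) (W (n + i))) ⟩
    sum (applyUpTo (λ i → indicator (W i) + indicator (W (n + i))) n)
      ≡⟨ sum-applyUpTo-+ (indicator ∘ W) (λ i → indicator (W (n + i))) n ⟩
    sum (applyUpTo (indicator ∘ W) n) + sum (applyUpTo (λ i → indicator (W (n + i))) n)
      ≡⟨ sum-++ (applyUpTo (indicator ∘ W) n) _ ⟨
    sum (applyUpTo (indicator ∘ W) n ++ applyUpTo (λ i → indicator (W (n + i))) n)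
      ≡⟨ cong sum (applyUpTo-+ (indicator ∘ W) n n) ⟨
    sum (applyUpTo (indicator ∘ W) (n + n))
      ≤⟨ sum-inWindow≤ (n + n) a m ⟩
    m ∎
    where
    open ≤-Reasoning
    W = inWindow a m

  paddedCube : ℕ → Subcube n
  paddedCube a = fixFree (m ∸ codim (windowCube a)) (windowCube a)

  codim-paddedCube : ∀ a → codim (paddedCube a) ≡ m
  codim-paddedCube a =
    trans (codim-fixFree (m ∸ k) (windowCube a) m∸k≤dim) (m∸n+n≡m (codim-windowCube≤ a))
    where
    k = codim (windowCube a)
    m∸k≤dim : m ∸ k ≤ dim (windowCube a)
    m∸k≤dim = subst (m ∸ k ≤_) (sym (dim≡n∸codim (windowCube a))) (∸-monoˡ-≤ k m≤n)

  chunkStart : ℕ → ℕ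
  chunkStart p = p / m * m

  chunkStart≤ : ∀ p → chunkStart p ≤ p
  chunkStart≤ p = m/n*n≤m p m

  <chunkStart+m : ∀ p → p < chunkStart p + m
  <chunkStart+m p = begin-strict
    p                    ≡⟨ m≡m%n+[m/n]*n p m ⟩
    p % m + chunkStart p <⟨ +-monoˡ-< (chunkStart p) (m%n<n p m) ⟩
    m + chunkStart p     ≡⟨ +-comm m (chunkStart p) ⟩
    chunkStart p + m     ∎
    where open ≤-Reasoning

  literalAt-chunk : ∀ b {i} → i < n → literalAt (chunkStart (position b i)) i ≡ just b
  literalAt-chunk false {i} _ =
    cong (λ w → literal w (inWindow (chunkStart i) m (n + i)))
         (inWindow-inside (chunkStart≤ i) (<chunkStart+m i))
  literalAt-chunk true  {i} _ =
    cong₂ literal (inWindow-before i<a)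
                  (inWindow-inside (chunkStart≤ (n + i)) (<chunkStart+m (n + i)))
    where
    a = chunkStart (n + i)
    i<a : i < a
    i<a = +-cancelʳ-< m i a (begin-strict
      i + m  ≤⟨ +-monoʳ-≤ i m≤n ⟩
      i + n  ≡⟨ +-comm i n ⟩
      n + i  <⟨ <chunkStart+m (n + i) ⟩
      a + m  ∎)
      where open ≤-Reasoning

  windowCubes : ℕ → List (Subcube n)
  windowCubes K = applyUpTo (paddedCube ∘ (_* m)) K

  windowCubes-cover : ∀ {K D i} b → 2 * n ≤ K * m → i < n →
    (∀ g → g i ≡ just b → tabulateℕ n g ⊑ D) → Any (_⊑ D) (windowCubes K)
  windowCubes-cover {K} {D} {i} b 2n≤Km i<n fixes =
    Any.applyUpTo⁺ (paddedCube ∘ (_* m)) paddedCube⊑D chunk<K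
    where
    p = position b i
    chunk<K : p / m < K
    chunk<K = m<n*o⇒m/o<n (<-≤-trans (position<2n b i<n) 2n≤Km)
    paddedCube⊑D : paddedCube (chunkStart p) ⊑ D
    paddedCube⊑D = ⊑-trans (fixFree-⊑ _ (windowCube (chunkStart p)))
                           (fixes (literalAt (chunkStart p)) (literalAt-chunk b i<n))

minCoveringSize-facets : ∀ n ℓ {m} → ℓ ≤ n → suc n ∸ ℓ ≡ suc m →
  IsMinCoveringSize (suc n) n ℓ (ceilDiv (2 * suc n) (suc m))
minCoveringSize-facets n ℓ {m} ℓ≤n codim≡ = isMinCoveringSize upper lower
  where
  open Windows (suc n) (suc m) (subst (_≤ suc n) codim≡ (m∸n≤m (suc n) ℓ))
  K = ceilDiv (2 * suc n) (suc m)

  dim-paddedCube : ∀ a → dim (paddedCube a) ≡ ℓ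
  dim-paddedCube a = begin
    dim (paddedCube a)           ≡⟨ dim≡n∸codim (paddedCube a) ⟩
    suc n ∸ codim (paddedCube a) ≡⟨ cong (suc n ∸_) (trans (codim-paddedCube a) (sym codim≡)) ⟩
    suc n ∸ (suc n ∸ ℓ)          ≡⟨ m∸[m∸n]≡n (≤-trans ℓ≤n (n≤1+n n)) ⟩
    ℓ                            ∎
    where open ≡-Reasoning

  cover : (d : Subcube (suc n)) → dim d ≡ n → Any (_⊑ d) (windowCubes K)
  cover d dim≡n =
    let i , b , i<n , fixes = facet-literal d dim≡n
    in  windowCubes-cover b (m≤ceilDiv*n (2 * suc n) m) i<n fixes

  upper : ∃ λ S → IsCoveringSet (suc n) n ℓ S × length S ≤ K
  upper =
    let S , covering , |S|≤ = deduplicate-coveringSet (windowCubes K)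
                                (All.applyUpTo⁺₂ _ K (dim-paddedCube ∘ (_* suc m))) cover
    in  S , covering , ≤-trans |S|≤ (≤-reflexive (length-applyUpTo _ K))

  lower : ∀ S → IsCoveringSet (suc n) n ℓ S → K ≤ length S
  lower S covering = m≤o*n⇒ceilDiv≤o
    (subst (λ k → 2 * suc n ≤ length S * k) codim≡ (coveringSet-lowerBound covering))

theorem4 : (n ℓ : ℕ) → 1 ≤ ℓ → ℓ < n ∸ 1 →
    IsMinCoveringSize n (n ∸ 1) ℓ (ceilDiv (2 * n) (n ∸ ℓ))
theorem4 zero    ℓ _ ()
theorem4 (suc n) ℓ _ ℓ<n =
  subst (IsMinCoveringSize (suc n) n ℓ ∘ ceilDiv (2 * suc n)) (sym codim≡)
        (minCoveringSize-facets n ℓ (<⇒≤ ℓ<n) codim≡)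
  where
  codim≡ : suc n ∸ ℓ ≡ suc (n ∸ ℓ)
  codim≡ = +-∸-assoc 1 (<⇒≤ ℓ<n)
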